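{- Let $\lambda\in\mathbb{R}$, $x\in[0,1]$, and $n,k\in\mathbb{N}\cup\{0\}$ with $n\ge k$. Then $$B_{k,n}(x|\lambda)=(x)_{k,\lambda}\sum_{m=k}^n\binom{n}{m}S_{2,\lambda}(m,k)\,\beta^{(k)}_{n-m,\lambda}(1-x).$$
   Context: For $\lambda\in\mathbb{R}$, $(x)_{0,\lambda}=1$ and $(x)_{n,\lambda}=x(x-\lambda)\cdots(x-(n-1)\lambda)$ for $n\ge1$. For $a\in\mathbb{R}$, $(1+\lambda t)^{a/\lambda}$ denotes the formal power series $\sum_{n\ge0}(a)_{n,\lambda}\frac{t^n}{n!}$ (equal to $e^{at}$ when $\lambda=0$). The degenerate Bernstein polynomials are $B_{k,n}(x|\lambda)=\binom{n}{k}(x)_{k,\lambda}(1-x)_{n-k,\lambda}$ for $0\le k\le n$, $x\in[0,1]$. The degenerate Stirling numbers of the second kind $S_{2,\lambda}(n,k)$ are defined by $\frac{1}{k!}\bigl((1+\lambda t)^{1/\lambda}-1\bigr)^k=\sum_{n\ge k}S_{2,\lambda}(n,k)\frac{t^n}{n!}$ for $k\ge0$. The degenerate Bernoulli polynomials of order $k$ (Carlitz) are defined by $\left(\frac{t}{(1+\lambda t)^{1/\lambda}-1}\right)^k(1+\lambda t)^{x/\lambda}=\sum_{n\ge0}\beta^{(k)}_{n,\lambda}(x)\frac{t^n}{n!}$. -}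

module Defs where

open import Level using (Level)
open import Data.Nat using (ℕ; zero; suc; _∸_; _≤ᵇ_; _≡ᵇ_)
open import Data.Bool using (true; false)
open import Data.Nat.Combinatorics using (_C_)
open import Algebra.Bundles using (CommutativeRing)

-- All definitions are carried out in an arbitrary commutative ring R,
-- together with a function  inv  where  inv n  is meant to be (n+1)⁻¹
-- (the theorem assumes  fromℕ (suc n) * inv n ≈ 1#).  ℝ is an instance.
module Degenerate {c ℓ : Level} (R : CommutativeRing c ℓ)
                  (inv : ℕ → CommutativeRing.Carrier R) where
  open CommutativeRing R

  fromℕ : ℕ → Carrier
  fromℕ zero    = 0#
  fromℕ (suc n) = 1# + fromℕ n

  sumBelow : ℕ → (ℕ → Carrier) → Carrier
  sumBelow zero    f = 0#
  sumBelow (suc n) f = sumBelow n f + f n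

  -- Σ_{m=a}^{b} f m  (empty if b < a)
  sumFromTo : ℕ → ℕ → (ℕ → Carrier) → Carrier
  sumFromTo a b f = sumBelow (suc b ∸ a) (λ i → f (a Data.Nat.+ i))

  fall : Carrier → Carrier → ℕ → Carrier
  fall l x zero    = 1#
  fall l x (suc n) = fall l x n * (x - fromℕ n * l)

  binom : ℕ → ℕ → Carrier
  binom n k = fromℕ (n C k)

  invFact : ℕ → Carrier
  invFact zero    = 1#
  invFact (suc k) = invFact k * inv k

  -- Formal power series in t, represented by their exponential coefficients:
  -- a : ℕ → R stands for  Σ_n a n t^n / n!.
  Series : Set c
  Series = ℕ → Carrier

  _⊛_ : Series → Series → Series
  (a ⊛ b) n = sumFromTo 0 n (λ i → binom n i * (a i * b (n ∸ i)))

  oneS : Series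
  oneS zero    = 1#
  oneS (suc n) = 0#

  powS : Series → ℕ → Series
  powS a zero    = oneS
  powS a (suc k) = a ⊛ powS a k

  scaleS : Carrier → Series → Series
  scaleS r a n = r * a n

  -- (1 + λ t)^{a/λ} = Σ_n (a)_{n,λ} t^n / n!
  degExp : Carrier → Carrier → Series
  degExp l a n = fall l a n

  -- (1 + λ t)^{1/λ} - 1
  degExpMinusOne : Carrier → Series
  degExpMinusOne l zero    = 0#
  degExpMinusOne l (suc n) = fall l 1# (suc n)

  -- ((1 + λ t)^{1/λ} - 1) / t :  coefficient of t^n/n! is (1)_{n+1,λ}/(n+1)
  degExpMinusOneOverT : Carrier → Series
  degExpMinusOneOverT l n = fall l 1# (suc n) * inv n

  -- multiplicative inverse of a series d with constant term 1:
  -- h 0 = 1,  h n = - Σ_{i=1}^{n} C(n,i) d_i h_{n-i}   (so that d ⊛ h = oneS).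
  -- invUpTo d n m is h m for m ≤ n (and 0 for m > n).
  invUpTo : Series → ℕ → Series
  invUpTo d zero    zero    = 1#
  invUpTo d zero    (suc m) = 0#
  invUpTo d (suc n) m with m ≤ᵇ n
  ... | true  = invUpTo d n m
  ... | false with m ≡ᵇ suc n
  ...   | true  = - sumBelow (suc n)
                      (λ j → binom (suc n) (suc j) * (d (suc j) * invUpTo d n (n ∸ j)))
  ...   | false = 0#

  invSeries : Series → Series
  invSeries d n = invUpTo d n n

  -- degenerate Stirling numbers of the second kind:
  -- (1/k!) ((1+λt)^{1/λ} - 1)^k = Σ_n S2λ(n,k) t^n/n!
  S2 : Carrier → ℕ → ℕ → Carrier
  S2 l n k = invFact k * powS (degExpMinusOne l) k n

  -- degenerate Bernoulli polynomials of order k (Carlitz):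
  -- (t / ((1+λt)^{1/λ} - 1))^k (1+λt)^{x/λ} = Σ_n β^{(k)}_{n,λ}(x) t^n/n!
  beta : Carrier → ℕ → ℕ → Carrier → Carrier
  beta l k n x = (powS (invSeries (degExpMinusOneOverT l)) k ⊛ degExp l x) n

  bern : Carrier → ℕ → ℕ → Carrier → Carrier
  bern l k n x = binom n k * (fall l x k * fall l (1# - x) (n ∸ k))

-- In the ring of exponential generating series (⊛ multiplies Σ aₙ tⁿ/n!),
-- put E = (1+λt)^{1/λ} - 1.  Then Σ_m C(n,m) S₂(m,k) β⁽ᵏ⁾_{n-m}(y) is the n-th
-- coefficient of (E^k/k!) · (t/E)^k (1+λt)^{y/λ} = t^k (1+λt)^{y/λ} / k!,
-- that is C(n,k) (y)_{n-k,λ}.  As S₂(m,k) = 0 for m < k the sum may start at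
-- m = k, and multiplying by (x)_{k,λ} with y = 1 - x gives B_{k,n}(x|λ).
module Submission where

open import Defs
open import Level using (Level)
open import Data.Nat using (ℕ; zero; suc; _≤_; _<_; _∸_; _!; _<ᵇ_; s≤s)
import Data.Nat as ℕ
import Data.Nat.Properties as ℕ
open import Data.Nat.Combinatorics using (_C_; nCk+nC[k+1]≡[n+1]C[k+1]; k>n⇒nCk≡0; nC1≡n)
open import Data.Bool using (false)
open import Data.Bool.Properties using (T-≡)
open import Data.Product using (_,_)
open import Function.Bundles using (Equivalence)
open import Data.Sum using (inj₁; inj₂)
open import Relation.Nullary using (Dec; yes; no)
open import Relation.Binary.PropositionalEquality as ≡ using (_≡_)
open import Relation.Binary.Structures using (IsEquivalence)
open import Algebra.Bundles using (CommutativeRing; CommutativeMonoid)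
open import Algebra.Structures using (IsCommutativeMonoid)
import Algebra.Properties.CommutativeSemigroup as CommutativeSemigroupProperties
import Algebra.Properties.Semiring.Mult as SemiringMult
import Algebra.Properties.Ring as RingProperties
import Algebra.Solver.Ring.NaturalCoefficients.Default as NaturalCoefficientsSolver
import Relation.Binary.Reasoning.Setoid as SetoidReasoning

module DegenerateSeries {c ℓ : Level} (R : CommutativeRing c ℓ)
                        (inv : ℕ → CommutativeRing.Carrier R) where
  open CommutativeRing R hiding (zero)
  open Degenerate R inv
  open SemiringMult semiring using (_×_; ×-homo-+; ×1-homo-*)
  open RingProperties ring using (-0#≈0#)
  open CommutativeSemigroupProperties *-commutativeSemigroup using (x∙yz≈y∙xz)
  open NaturalCoefficientsSolver commutativeSemiring using (solve; _:=_; _:+_; _:*_)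
  open SetoidReasoning setoid

  fromℕ≡×1# : ∀ n → fromℕ n ≡ n × 1#
  fromℕ≡×1# zero    = ≡.refl
  fromℕ≡×1# (suc n) = ≡.cong (1# +_) (fromℕ≡×1# n)

  fromℕ-+ : ∀ m n → fromℕ (m ℕ.+ n) ≈ fromℕ m + fromℕ n
  fromℕ-+ m n rewrite fromℕ≡×1# (m ℕ.+ n) | fromℕ≡×1# m | fromℕ≡×1# n = ×-homo-+ 1# m n

  fromℕ-* : ∀ m n → fromℕ (m ℕ.* n) ≈ fromℕ m * fromℕ n
  fromℕ-* m n rewrite fromℕ≡×1# (m ℕ.* n) | fromℕ≡×1# m | fromℕ≡×1# n = ×1-homo-* m n

  sumBelow-cong< : ∀ n {f g : ℕ → Carrier} → (∀ i → i < n → f i ≈ g i) →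
                   sumBelow n f ≈ sumBelow n g
  sumBelow-cong< zero    f≈g = refl
  sumBelow-cong< (suc n) f≈g =
    +-cong (sumBelow-cong< n (λ i i<n → f≈g i (ℕ.m<n⇒m<1+n i<n))) (f≈g n (ℕ.n<1+n n))

  sumBelow-cong : ∀ n {f g : ℕ → Carrier} → (∀ i → f i ≈ g i) → sumBelow n f ≈ sumBelow n g
  sumBelow-cong n f≈g = sumBelow-cong< n (λ i _ → f≈g i)

  sumBelow-vanish : ∀ n {f : ℕ → Carrier} → (∀ i → i < n → f i ≈ 0#) → sumBelow n f ≈ 0#
  sumBelow-vanish zero    f≈0 = refl
  sumBelow-vanish (suc n) f≈0 =
    trans (+-cong (sumBelow-vanish n (λ i i<n → f≈0 i (ℕ.m<n⇒m<1+n i<n))) (f≈0 n (ℕ.n<1+n n)))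
          (+-identityʳ 0#)

  sumBelow-+ : ∀ n (f g : ℕ → Carrier) →
               sumBelow n (λ i → f i + g i) ≈ sumBelow n f + sumBelow n g
  sumBelow-+ zero    f g = sym (+-identityʳ 0#)
  sumBelow-+ (suc n) f g = trans (+-congʳ (sumBelow-+ n f g))
    (solve 4 (λ a b x y → (a :+ b) :+ (x :+ y) := (a :+ x) :+ (b :+ y)) refl _ _ _ _)

  sumBelow-*ˡ : ∀ n r (f : ℕ → Carrier) → sumBelow n (λ i → r * f i) ≈ r * sumBelow n f
  sumBelow-*ˡ zero    r f = sym (zeroʳ r)
  sumBelow-*ˡ (suc n) r f = trans (+-congʳ (sumBelow-*ˡ n r f)) (sym (distribˡ r _ _))

  sumBelow-suc : ∀ n (f : ℕ → Carrier) → sumBelow (suc n) f ≈ f 0 + sumBelow n (λ i → f (suc i))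
  sumBelow-suc zero    f = +-comm 0# (f 0)
  sumBelow-suc (suc n) f = trans (+-congʳ (sumBelow-suc n f)) (+-assoc _ _ _)

  sumBelow-split : ∀ k r (f : ℕ → Carrier) →
                   sumBelow (k ℕ.+ r) f ≈ sumBelow k f + sumBelow r (λ i → f (k ℕ.+ i))
  sumBelow-split zero    r f = sym (+-identityˡ _)
  sumBelow-split (suc k) r f = begin
    sumBelow (suc (k ℕ.+ r)) f                            ≈⟨ sumBelow-suc (k ℕ.+ r) f ⟩
    f 0 + sumBelow (k ℕ.+ r) (λ i → f (suc i))            ≈⟨ +-congˡ (sumBelow-split k r (λ i → f (suc i))) ⟩
    f 0 + (sumBelow k (λ i → f (suc i)) + _)              ≈⟨ +-assoc _ _ _ ⟨
    (f 0 + sumBelow k (λ i → f (suc i))) + _              ≈⟨ +-congʳ (sumBelow-suc k f) ⟨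
    sumBelow (suc k) f + sumBelow r (λ i → f (suc k ℕ.+ i)) ∎

  sumFromTo≈sumBelow : ∀ {k n} (f : ℕ → Carrier) → k ≤ n → (∀ m → m < k → f m ≈ 0#) →
                       sumFromTo k n f ≈ sumBelow (suc n) f
  sumFromTo≈sumBelow {k} {n} f k≤n f≈0 = begin
    sumBelow (suc n ∸ k) (λ i → f (k ℕ.+ i))              ≈⟨ +-identityˡ _ ⟨
    0# + sumBelow (suc n ∸ k) (λ i → f (k ℕ.+ i))         ≈⟨ +-congʳ (sumBelow-vanish k f≈0) ⟨
    sumBelow k f + sumBelow (suc n ∸ k) (λ i → f (k ℕ.+ i)) ≈⟨ sumBelow-split k (suc n ∸ k) f ⟨
    sumBelow (k ℕ.+ (suc n ∸ k)) f                        ≡⟨ ≡.cong (λ m → sumBelow m f) (ℕ.m+[n∸m]≡n (ℕ.m≤n⇒m≤1+n k≤n)) ⟩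
    sumBelow (suc n) f                                    ∎

  binom-zero : ∀ n → binom n 0 ≈ 1#
  binom-zero n = +-identityʳ 1#

  binom-one : ∀ n → binom n 1 ≈ fromℕ n
  binom-one n = reflexive (≡.cong fromℕ (nC1≡n n))

  binom-pascal : ∀ n k → binom (suc n) (suc k) ≈ binom n k + binom n (suc k)
  binom-pascal n k = trans (reflexive (≡.cong fromℕ (≡.sym (nCk+nC[k+1]≡[n+1]C[k+1] n k))))
                           (fromℕ-+ (n C k) (n C suc k))

  binom-vanish : ∀ {n k} → n < k → binom n k ≈ 0#
  binom-vanish n<k = reflexive (≡.cong fromℕ (k>n⇒nCk≡0 n<k))

  _≐_ : Series → Series → Set ℓ
  a ≐ b = ∀ n → a n ≈ b n

  infix 4 _≐_

  ≐-isEquivalence : IsEquivalence _≐_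
  ≐-isEquivalence = record
    { refl  = λ _ → refl
    ; sym   = λ a≐b n → sym (a≐b n)
    ; trans = λ a≐b b≐c n → trans (a≐b n) (b≐c n)
    }

  -- On exponential generating series, shifting the coefficients is differentiation.
  ∂ : Series → Series
  ∂ a n = a (suc n)

  _⊕_ : Series → Series → Series
  (a ⊕ b) n = a n + b n

  ⊛-cong : ∀ {a a′ b b′} → a ≐ a′ → b ≐ b′ → (a ⊛ b) ≐ (a′ ⊛ b′)
  ⊛-cong a≐a′ b≐b′ n = sumBelow-cong (suc n) (λ i → *-congˡ (*-cong (a≐a′ i) (b≐b′ (n ∸ i))))

  ⊛-at-zero : ∀ a b → (a ⊛ b) 0 ≈ a 0 * b 0
  ⊛-at-zero a b = trans (+-identityˡ _) (trans (*-congʳ (binom-zero 0)) (*-identityˡ _))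

  ⊛-distribʳ : ∀ a b c → ((a ⊕ b) ⊛ c) ≐ ((a ⊛ c) ⊕ (b ⊛ c))
  ⊛-distribʳ a b c n = trans (sumBelow-cong (suc n) (λ i → trans (*-congˡ (distribʳ _ _ _)) (distribˡ _ _ _)))
                             (sumBelow-+ (suc n) _ _)

  ⊛-distribˡ : ∀ a b c → (a ⊛ (b ⊕ c)) ≐ ((a ⊛ b) ⊕ (a ⊛ c))
  ⊛-distribˡ a b c n = trans (sumBelow-cong (suc n) (λ i → trans (*-congˡ (distribˡ _ _ _)) (distribˡ _ _ _)))
                             (sumBelow-+ (suc n) _ _)

  -- Pascal's rule for the coefficients turns into the product rule.
  ∂-⊛ : ∀ a b → ∂ (a ⊛ b) ≐ ((∂ a ⊛ b) ⊕ (a ⊛ ∂ b))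
  ∂-⊛ a b n = begin
    (a ⊛ b) (suc n)                                     ≈⟨ sumBelow-suc (suc n) _ ⟩
    first + sumBelow (suc n) (λ j → binom (suc n) (suc j) * term j)
      ≈⟨ +-congˡ (sumBelow-cong (suc n) (λ j → trans (*-congʳ (binom-pascal n j)) (distribʳ _ _ _))) ⟩
    first + sumBelow (suc n) (λ j → left j + right j)   ≈⟨ +-congˡ (sumBelow-+ (suc n) left right) ⟩
    first + ((∂ a ⊛ b) n + (sumBelow n right + right n))
      ≈⟨ +-congˡ (+-congˡ (+-cong (sumBelow-cong< n right≈) right-last)) ⟩
    first + ((∂ a ⊛ b) n + (sumBelow n (λ j → binom n (suc j) * (a (suc j) * ∂ b (n ∸ suc j))) + 0#))
      ≈⟨ solve 3 (λ f s r → f :+ (s :+ (r :+ con 0)) := s :+ (f :+ r)) refl first _ _ ⟩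
    (∂ a ⊛ b) n + (first + _)                           ≈⟨ +-congˡ (trans (sumBelow-suc n _) (+-congʳ first≈)) ⟨
    (∂ a ⊛ b) n + (a ⊛ ∂ b) n                           ∎
    where
    open NaturalCoefficientsSolver commutativeSemiring using (con)
    term  = λ j → a (suc j) * b (n ∸ j)
    first = binom (suc n) 0 * (a 0 * b (suc n))
    left  = λ j → binom n j * term j
    right = λ j → binom n (suc j) * term j
    right≈ : ∀ j → j < n → right j ≈ binom n (suc j) * (a (suc j) * ∂ b (n ∸ suc j))
    right≈ j j<n = reflexive (≡.cong (λ m → binom n (suc j) * (a (suc j) * b m)) (ℕ.+-∸-assoc 1 j<n))
    right-last : right n ≈ 0#
    right-last = trans (*-congʳ (binom-vanish (ℕ.n<1+n n))) (zeroˡ _)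
    first≈ : binom n 0 * (a 0 * b (suc n)) ≈ first
    first≈ = *-congʳ (trans (binom-zero n) (sym (binom-zero (suc n))))

  -- Both laws follow by induction on the index from the product rule.
  ⊛-assoc : ∀ a b c → ((a ⊛ b) ⊛ c) ≐ (a ⊛ (b ⊛ c))
  ⊛-assoc a b c zero = begin
    ((a ⊛ b) ⊛ c) 0       ≈⟨ ⊛-at-zero (a ⊛ b) c ⟩
    (a ⊛ b) 0 * c 0       ≈⟨ *-congʳ (⊛-at-zero a b) ⟩
    (a 0 * b 0) * c 0     ≈⟨ *-assoc _ _ _ ⟩
    a 0 * (b 0 * c 0)     ≈⟨ *-congˡ (⊛-at-zero b c) ⟨
    a 0 * (b ⊛ c) 0       ≈⟨ ⊛-at-zero a (b ⊛ c) ⟨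
    (a ⊛ (b ⊛ c)) 0       ∎
  ⊛-assoc a b c (suc n) = begin
    ((a ⊛ b) ⊛ c) (suc n)
      ≈⟨ ∂-⊛ (a ⊛ b) c n ⟩
    (∂ (a ⊛ b) ⊛ c) n + ((a ⊛ b) ⊛ ∂ c) n
      ≈⟨ +-congʳ (trans (⊛-cong {b = c} (∂-⊛ a b) (λ _ → refl) n) (⊛-distribʳ (∂ a ⊛ b) (a ⊛ ∂ b) c n)) ⟩
    (((∂ a ⊛ b) ⊛ c) n + ((a ⊛ ∂ b) ⊛ c) n) + ((a ⊛ b) ⊛ ∂ c) n
      ≈⟨ +-cong (+-cong (⊛-assoc (∂ a) b c n) (⊛-assoc a (∂ b) c n)) (⊛-assoc a b (∂ c) n) ⟩
    ((∂ a ⊛ (b ⊛ c)) n + (a ⊛ (∂ b ⊛ c)) n) + (a ⊛ (b ⊛ ∂ c)) n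
      ≈⟨ +-assoc _ _ _ ⟩
    (∂ a ⊛ (b ⊛ c)) n + ((a ⊛ (∂ b ⊛ c)) n + (a ⊛ (b ⊛ ∂ c)) n)
      ≈⟨ +-congˡ (trans (⊛-cong (λ _ → refl) (∂-⊛ b c) n) (⊛-distribˡ a (∂ b ⊛ c) (b ⊛ ∂ c) n)) ⟨
    (∂ a ⊛ (b ⊛ c)) n + (a ⊛ ∂ (b ⊛ c)) n
      ≈⟨ ∂-⊛ a (b ⊛ c) n ⟨
    (a ⊛ (b ⊛ c)) (suc n) ∎

  ⊛-comm : ∀ a b → (a ⊛ b) ≐ (b ⊛ a)
  ⊛-comm a b zero    = trans (⊛-at-zero a b) (trans (*-comm _ _) (sym (⊛-at-zero b a)))
  ⊛-comm a b (suc n) = begin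
    (a ⊛ b) (suc n)                 ≈⟨ ∂-⊛ a b n ⟩
    (∂ a ⊛ b) n + (a ⊛ ∂ b) n       ≈⟨ +-cong (⊛-comm (∂ a) b n) (⊛-comm a (∂ b) n) ⟩
    (b ⊛ ∂ a) n + (∂ b ⊛ a) n       ≈⟨ +-comm _ _ ⟩
    (∂ b ⊛ a) n + (b ⊛ ∂ a) n       ≈⟨ ∂-⊛ b a n ⟨
    (b ⊛ a) (suc n)                 ∎

  ⊛-identityˡ : ∀ a → (oneS ⊛ a) ≐ a
  ⊛-identityˡ a n = begin
    (oneS ⊛ a) n                   ≈⟨ sumBelow-suc n _ ⟩
    binom n 0 * (1# * a n) + _     ≈⟨ +-cong (trans (*-congʳ (binom-zero n)) (trans (*-identityˡ _) (*-identityˡ _)))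
                                             (sumBelow-vanish n (λ _ _ → trans (*-congˡ (zeroˡ _)) (zeroʳ _))) ⟩
    a n + 0#                       ≈⟨ +-identityʳ _ ⟩
    a n                            ∎

  ⊛-isCommutativeMonoid : IsCommutativeMonoid _≐_ _⊛_ oneS
  ⊛-isCommutativeMonoid = record
    { isMonoid = record
      { isSemigroup = record
        { isMagma = record { isEquivalence = ≐-isEquivalence ; ∙-cong = ⊛-cong }
        ; assoc   = ⊛-assoc
        }
      ; identity = ⊛-identityˡ , λ a n → trans (⊛-comm a oneS n) (⊛-identityˡ a n)
      }
    ; comm = ⊛-comm
    }

  ⊛-commutativeMonoid : CommutativeMonoid c ℓ
  ⊛-commutativeMonoid = record { isCommutativeMonoid = ⊛-isCommutativeMonoid }

  open CommutativeMonoid ⊛-commutativeMonoid using ()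
    renaming (refl to ≐-refl; sym to ≐-sym; trans to ≐-trans)
  open CommutativeSemigroupProperties (CommutativeMonoid.commutativeSemigroup ⊛-commutativeMonoid)
    using (interchange)

  powS-cong : ∀ {a b} → a ≐ b → ∀ k → powS a k ≐ powS b k
  powS-cong a≐b zero    = ≐-refl
  powS-cong a≐b (suc k) = ⊛-cong a≐b (powS-cong a≐b k)

  powS-⊛-distrib : ∀ a b k → powS (a ⊛ b) k ≐ (powS a k ⊛ powS b k)
  powS-⊛-distrib a b zero    = ≐-sym (⊛-identityˡ oneS)
  powS-⊛-distrib a b (suc k) =
    ≐-trans (⊛-cong ≐-refl (powS-⊛-distrib a b k)) (interchange a b (powS a k) (powS b k))

  powS-oneS : ∀ k → powS oneS k ≐ oneS
  powS-oneS zero    = ≐-refl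
  powS-oneS (suc k) = ≐-trans (⊛-cong ≐-refl (powS-oneS k)) (⊛-identityˡ oneS)

  scaleS-⊛ : ∀ r a b → (scaleS r a ⊛ b) ≐ scaleS r (a ⊛ b)
  scaleS-⊛ r a b n = trans (sumBelow-cong (suc n) (λ i → trans (*-congˡ (*-assoc r _ _)) (x∙yz≈y∙xz _ r _)))
                           (sumBelow-*ˡ (suc n) r _)

  -- monomial k is the series t^k/k!.
  monomial : ℕ → Series
  monomial zero    n       = oneS n
  monomial (suc k) zero    = 0#
  monomial (suc k) (suc n) = monomial k n

  monomial-⊛ : ∀ k a n → (monomial k ⊛ a) n ≈ binom n k * a (n ∸ k)
  monomial-⊛ zero    a n       = trans (⊛-identityˡ a n) (sym (trans (*-congʳ (binom-zero n)) (*-identityˡ _)))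
  monomial-⊛ (suc k) a zero    = trans (⊛-at-zero (monomial (suc k)) a)
    (trans (zeroˡ _) (sym (trans (*-congʳ (binom-vanish {0} {suc k} (s≤s ℕ.z≤n))) (zeroˡ _))))
  monomial-⊛ (suc k) a (suc n) = begin
    (monomial (suc k) ⊛ a) (suc n)                             ≈⟨ ∂-⊛ (monomial (suc k)) a n ⟩
    (monomial k ⊛ a) n + (monomial (suc k) ⊛ ∂ a) n            ≈⟨ +-cong (monomial-⊛ k a n) (monomial-⊛ (suc k) (∂ a) n) ⟩
    binom n k * a (n ∸ k) + binom n (suc k) * ∂ a (n ∸ suc k) ≈⟨ +-congˡ (shifted (k ℕ.<? n)) ⟩
    binom n k * a (n ∸ k) + binom n (suc k) * a (n ∸ k)       ≈⟨ distribʳ _ _ _ ⟨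
    (binom n k + binom n (suc k)) * a (n ∸ k)                 ≈⟨ *-congʳ (binom-pascal n k) ⟨
    binom (suc n) (suc k) * a (n ∸ k)                         ∎
    where
    shifted : Dec (k < n) → binom n (suc k) * ∂ a (n ∸ suc k) ≈ binom n (suc k) * a (n ∸ k)
    shifted (yes k<n) = reflexive (≡.cong (λ m → binom n (suc k) * a m) (≡.sym (ℕ.+-∸-assoc 1 k<n)))
    shifted (no k≮n)  = trans (*-congʳ vanish) (trans (zeroˡ _) (sym (trans (*-congʳ vanish) (zeroˡ _))))
      where vanish = binom-vanish (s≤s (ℕ.≮⇒≥ k≮n))

  t : Series
  t = monomial 1

  fromℕ-*-monomial : ∀ k n → fromℕ n * monomial k n ≈ fromℕ k * monomial k n
  fromℕ-*-monomial zero    zero    = refl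
  fromℕ-*-monomial zero    (suc n) = trans (zeroʳ _) (sym (zeroʳ _))
  fromℕ-*-monomial (suc k) zero    = trans (zeroʳ _) (sym (zeroʳ _))
  fromℕ-*-monomial (suc k) (suc n) =
    trans (distribʳ _ _ _) (trans (+-congˡ (fromℕ-*-monomial k n)) (sym (distribʳ _ _ _)))

  t⊛monomial : ∀ k → (t ⊛ monomial k) ≐ scaleS (fromℕ (suc k)) (monomial (suc k))
  t⊛monomial k zero    = trans (⊛-at-zero t (monomial k)) (trans (zeroˡ _) (sym (zeroʳ _)))
  t⊛monomial k (suc n) =
    trans (monomial-⊛ 1 (monomial k) (suc n)) (trans (*-congʳ (binom-one (suc n))) (fromℕ-*-monomial (suc k) (suc n)))

  powS-t : ∀ k → powS t k ≐ scaleS (fromℕ (k !)) (monomial k)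
  powS-t zero    n = sym (trans (*-congʳ (+-identityʳ 1#)) (*-identityˡ _))
  powS-t (suc k) n = begin
    (t ⊛ powS t k) n                                          ≈⟨ ⊛-cong ≐-refl (powS-t k) n ⟩
    (t ⊛ scaleS (fromℕ (k !)) (monomial k)) n                 ≈⟨ ⊛-comm t _ n ⟩
    (scaleS (fromℕ (k !)) (monomial k) ⊛ t) n                 ≈⟨ scaleS-⊛ _ (monomial k) t n ⟩
    fromℕ (k !) * (monomial k ⊛ t) n                          ≈⟨ *-congˡ (trans (⊛-comm _ t n) (t⊛monomial k n)) ⟩
    fromℕ (k !) * (fromℕ (suc k) * monomial (suc k) n)        ≈⟨ *-assoc _ _ _ ⟨
    (fromℕ (k !) * fromℕ (suc k)) * monomial (suc k) n        ≈⟨ *-congʳ (trans (*-comm _ _) (sym (fromℕ-* (suc k) (k !)))) ⟩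
    fromℕ (suc k !) * monomial (suc k) n                      ∎

  powS-t-⊛ : ∀ k a n → (powS t k ⊛ a) n ≈ fromℕ (k !) * (binom n k * a (n ∸ k))
  powS-t-⊛ k a n =
    trans (⊛-cong {b = a} (powS-t k) ≐-refl n) (trans (scaleS-⊛ _ (monomial k) a n) (*-congˡ (monomial-⊛ k a n)))

  invUpTo-stable : ∀ d {n m} → m ≤ n → invUpTo d n m ≡ invSeries d m
  invUpTo-stable d {zero}  ℕ.z≤n = ≡.refl
  invUpTo-stable d {suc n} {m} m≤1+n with ℕ.m≤n⇒m<n∨m≡n m≤1+n
  ... | inj₂ ≡.refl = ≡.refl
  ... | inj₁ (s≤s m≤n) rewrite Equivalence.to T-≡ (ℕ.≤⇒≤ᵇ m≤n) = invUpTo-stable d m≤n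

  n<ᵇn≡false : ∀ n → (n <ᵇ n) ≡ false
  n<ᵇn≡false zero    = ≡.refl
  n<ᵇn≡false (suc n) = n<ᵇn≡false n

  invSeries-suc : ∀ d n → invSeries d (suc n) ≈
    - sumBelow (suc n) (λ j → binom (suc n) (suc j) * (d (suc j) * invSeries d (n ∸ j)))
  invSeries-suc d n rewrite n<ᵇn≡false n | Equivalence.to T-≡ (ℕ.≡⇒≡ᵇ n n ≡.refl) =
    -‿cong (sumBelow-cong (suc n) (λ j → reflexive
      (≡.cong (λ h → binom (suc n) (suc j) * (d (suc j) * h)) (invUpTo-stable d (ℕ.m∸n≤m n j)))))

  ⊛-invSeries : ∀ d → d 0 ≈ 1# → (d ⊛ invSeries d) ≐ oneS
  ⊛-invSeries d d₀≈1 zero    = trans (⊛-at-zero d (invSeries d)) (trans (*-identityʳ _) d₀≈1)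
  ⊛-invSeries d d₀≈1 (suc n) = begin
    (d ⊛ invSeries d) (suc n)                              ≈⟨ sumBelow-suc (suc n) _ ⟩
    binom (suc n) 0 * (d 0 * invSeries d (suc n)) + rest   ≈⟨ +-congʳ leading ⟩
    - rest + rest                                          ≈⟨ -‿inverseˡ rest ⟩
    0#                                                     ∎
    where
    rest = sumBelow (suc n) (λ j → binom (suc n) (suc j) * (d (suc j) * invSeries d (n ∸ j)))
    leading : binom (suc n) 0 * (d 0 * invSeries d (suc n)) ≈ - rest
    leading = begin
      binom (suc n) 0 * (d 0 * invSeries d (suc n))  ≈⟨ *-cong (binom-zero (suc n)) (*-congʳ d₀≈1) ⟩
      1# * (1# * invSeries d (suc n))                ≈⟨ trans (*-identityˡ _) (*-identityˡ _) ⟩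
      invSeries d (suc n)                            ≈⟨ invSeries-suc d n ⟩
      - rest                                         ∎

  module WithInverses (inv-inverse : ∀ n → fromℕ (suc n) * inv n ≈ 1#) where

    invFact-*-fromℕ! : ∀ k → invFact k * fromℕ (k !) ≈ 1#
    invFact-*-fromℕ! zero    = trans (*-identityˡ _) (+-identityʳ 1#)
    invFact-*-fromℕ! (suc k) = begin
      invFact k * inv k * fromℕ (suc k ℕ.* k !)                ≈⟨ *-congˡ (fromℕ-* (suc k) (k !)) ⟩
      invFact k * inv k * (fromℕ (suc k) * fromℕ (k !))
        ≈⟨ solve 4 (λ a b p q → a :* b :* (p :* q) := (a :* q) :* (p :* b)) refl _ _ _ _ ⟩
      (invFact k * fromℕ (k !)) * (fromℕ (suc k) * inv k)      ≈⟨ *-cong (invFact-*-fromℕ! k) (inv-inverse k) ⟩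
      1# * 1#                                                  ≈⟨ *-identityˡ 1# ⟩
      1#                                                       ∎

    degExpMinusOneOverT-zero : ∀ l → degExpMinusOneOverT l 0 ≈ 1#
    degExpMinusOneOverT-zero l = trans (*-congʳ (trans (*-identityˡ _) (+-congˡ -[0*l]≈0))) (inv-inverse 0)
      where -[0*l]≈0 = trans (-‿cong (zeroˡ l)) -0#≈0#

    degExpMinusOne≐t⊛ : ∀ l → degExpMinusOne l ≐ (t ⊛ degExpMinusOneOverT l)
    degExpMinusOne≐t⊛ l zero    = sym (trans (⊛-at-zero t (degExpMinusOneOverT l)) (zeroˡ _))
    degExpMinusOne≐t⊛ l (suc n) = sym (begin
      (t ⊛ degExpMinusOneOverT l) (suc n)                   ≈⟨ monomial-⊛ 1 (degExpMinusOneOverT l) (suc n) ⟩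
      binom (suc n) 1 * (fall l 1# (suc n) * inv n)         ≈⟨ *-congʳ (binom-one (suc n)) ⟩
      fromℕ (suc n) * (fall l 1# (suc n) * inv n)           ≈⟨ x∙yz≈y∙xz _ _ _ ⟩
      fall l 1# (suc n) * (fromℕ (suc n) * inv n)           ≈⟨ *-congˡ (inv-inverse n) ⟩
      fall l 1# (suc n) * 1#                                ≈⟨ *-identityʳ _ ⟩
      fall l 1# (suc n)                                     ∎)

    powS-degExpMinusOne : ∀ l k → powS (degExpMinusOne l) k ≐ (powS t k ⊛ powS (degExpMinusOneOverT l) k)
    powS-degExpMinusOne l k = ≐-trans (powS-cong (degExpMinusOne≐t⊛ l) k) (powS-⊛-distrib t (degExpMinusOneOverT l) k)

    S2-vanish : ∀ l {m k} → m < k → S2 l m k ≈ 0#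
    S2-vanish l {m} {k} m<k = trans (*-congˡ P≈0) (zeroʳ _)
      where
      P≈0 : powS (degExpMinusOne l) k m ≈ 0#
      P≈0 = trans (powS-degExpMinusOne l k m) (trans (powS-t-⊛ k (powS (degExpMinusOneOverT l) k) m)
                  (trans (*-congˡ (trans (*-congʳ (binom-vanish m<k)) (zeroˡ _))) (zeroʳ _)))

    -- E^k (t/E)^k = t^k, where E = (1+λt)^{1/λ} - 1.
    powS-degExpMinusOne-⊛-beta : ∀ l k y →
      (powS (degExpMinusOne l) k ⊛ (powS (invSeries (degExpMinusOneOverT l)) k ⊛ degExp l y)) ≐ (powS t k ⊛ degExp l y)
    powS-degExpMinusOne-⊛-beta l k y n = begin
      (powS E k ⊛ (powS H k ⊛ G)) n             ≈⟨ ⊛-cong {b = powS H k ⊛ G} (powS-degExpMinusOne l k) ≐-refl n ⟩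
      ((powS t k ⊛ powS D k) ⊛ (powS H k ⊛ G)) n ≈⟨ ⊛-assoc (powS t k) (powS D k) (powS H k ⊛ G) n ⟩
      (powS t k ⊛ (powS D k ⊛ (powS H k ⊛ G))) n ≈⟨ ⊛-cong {a = powS t k} ≐-refl (≐-sym (⊛-assoc (powS D k) (powS H k) G)) n ⟩
      (powS t k ⊛ ((powS D k ⊛ powS H k) ⊛ G)) n ≈⟨ ⊛-cong {a = powS t k} ≐-refl (⊛-cong {b = G} D^kH^k≐oneS ≐-refl) n ⟩
      (powS t k ⊛ (oneS ⊛ G)) n                  ≈⟨ ⊛-cong {a = powS t k} ≐-refl (⊛-identityˡ G) n ⟩
      (powS t k ⊛ G) n                           ∎
      where
      E = degExpMinusOne l
      D = degExpMinusOneOverT l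
      H = invSeries D
      G = degExp l y
      D^kH^k≐oneS : (powS D k ⊛ powS H k) ≐ oneS
      D^kH^k≐oneS = ≐-trans (≐-sym (powS-⊛-distrib D H k))
                            (≐-trans (powS-cong (⊛-invSeries D (degExpMinusOneOverT-zero l)) k) (powS-oneS k))

    binom-*-S2-*-beta : ∀ l k n y →
      sumBelow (suc n) (λ m → binom n m * (S2 l m k * beta l k (n ∸ m) y)) ≈ binom n k * fall l y (n ∸ k)
    binom-*-S2-*-beta l k n y = begin
      sumBelow (suc n) (λ m → binom n m * (S2 l m k * beta l k (n ∸ m) y))
        ≈⟨ sumBelow-cong (suc n) (λ m → trans (*-congˡ (*-assoc _ _ _)) (x∙yz≈y∙xz _ _ _)) ⟩
      sumBelow (suc n) (λ m → invFact k * (binom n m * (P m * Q (n ∸ m))))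
        ≈⟨ sumBelow-*ˡ (suc n) _ _ ⟩
      invFact k * (P ⊛ Q) n                                   ≈⟨ *-congˡ (powS-degExpMinusOne-⊛-beta l k y n) ⟩
      invFact k * (powS t k ⊛ G) n                            ≈⟨ *-congˡ (powS-t-⊛ k G n) ⟩
      invFact k * (fromℕ (k !) * (binom n k * G (n ∸ k)))     ≈⟨ *-assoc _ _ _ ⟨
      (invFact k * fromℕ (k !)) * (binom n k * G (n ∸ k))     ≈⟨ *-congʳ (invFact-*-fromℕ! k) ⟩
      1# * (binom n k * G (n ∸ k))                            ≈⟨ *-identityˡ _ ⟩
      binom n k * fall l y (n ∸ k)                            ∎
      where
      P = powS (degExpMinusOne l) k
      G = degExp l y
      Q = powS (invSeries (degExpMinusOneOverT l)) k ⊛ G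

theorem2p7 : ∀ {c ℓ : Level} (R : CommutativeRing c ℓ)
               (inv : ℕ → CommutativeRing.Carrier R) →
               let open CommutativeRing R
                   open Degenerate R inv
               in (∀ n → fromℕ (suc n) * inv n ≈ 1#) →
                  ∀ (l x : Carrier) (n k : ℕ) → k ≤ n →
                  bern l k n x ≈
                    fall l x k * sumFromTo k n (λ m → binom n m * (S2 l m k * beta l k (n ∸ m) (1# - x)))
theorem2p7 R inv inv-inverse l x n k k≤n = begin
  binom n k * (fall l x k * fall l (1# - x) (n ∸ k))  ≈⟨ x∙yz≈y∙xz _ _ _ ⟩
  fall l x k * (binom n k * fall l (1# - x) (n ∸ k))  ≈⟨ *-congˡ (binom-*-S2-*-beta l k n (1# - x)) ⟨
  fall l x k * sumBelow (suc n) term                  ≈⟨ *-congˡ (sumFromTo≈sumBelow term k≤n term-vanish) ⟨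
  fall l x k * sumFromTo k n term                     ∎
  where
  open CommutativeRing R
  open Degenerate R inv
  open DegenerateSeries R inv
  open WithInverses inv-inverse
  open SetoidReasoning setoid
  open CommutativeSemigroupProperties *-commutativeSemigroup using (x∙yz≈y∙xz)
  term : ℕ → Carrier
  term m = binom n m * (S2 l m k * beta l k (n ∸ m) (1# - x))
  term-vanish : ∀ m → m < k → term m ≈ 0#
  term-vanish m m<k = trans (*-congˡ (trans (*-congʳ (S2-vanish l m<k)) (zeroˡ _))) (zeroʳ _)
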